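{- Let $k\geq 2$ and let $n\geq 2$ be the largest natural number such that $k\geq\binom{n}{2}+1$. Then $\psi(k)\geq n$. Equivalently: for every surjective colouring $\Delta:\mathbb{N}^{(2)}\to[k]$, the set $\mathcal{F}_{\Delta}$ has at least $n$ elements.
   Context: For a set $X$, $X^{(2)}$ denotes the set of unordered pairs of elements of $X$ (the edges of the complete graph on $X$), and $[k]=\{1,\dots,k\}$. Given a surjective colouring $\Delta:\mathbb{N}^{(2)}\to[k]$, a set $X\subset\mathbb{N}$ is called (exactly) $m$-coloured if $\Delta(X^{(2)})$, the set of colours of edges with both endpoints in $X$, has exactly $m$ elements. Define $\mathcal{F}_{\Delta}=\{m\in[k] : \text{there is an infinite } m\text{ -coloured } X\subset\mathbb{N}\}$ and $\psi(k)=\min|\mathcal{F}_{\Delta}|$, the minimum over all surjective colourings $\Delta:\mathbb{N}^{(2)}\to[k]$. -}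

module Defs where

open import Level using (0ℓ)
open import Data.Nat using (ℕ; _≤_; _<_)
open import Data.Fin using (Fin)
open import Data.Fin.Subset using (Subset; _∈_; ∣_∣)
open import Data.Product using (Σ; ∃; ∃-syntax; _×_)
open import Relation.Binary.PropositionalEquality using (_≡_)
open import Function.Bundles using (_⇔_)
open import Function.Definitions using (Injective)

-- An unordered pair {x,y} is represented by
-- its increasing presentation x < y; only the values Δ x y with x < y are
-- ever used, so a function ℕ → ℕ → Fin k restricted to x < y is exactly a
-- map from the edges of the complete graph on ℕ to [k] (colour c ∈ Fin k
-- stands for colour toℕ c + 1 ∈ [k]).
Colouring : ℕ → Set
Colouring k = ℕ → ℕ → Fin k

Surjective : ∀ {k} → Colouring k → Set
Surjective {k} Δ = (c : Fin k) → ∃[ x ] ∃[ y ] (x < y × Δ x y ≡ c)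

SubsetN : Set₁
SubsetN = ℕ → Set

Infinite : SubsetN → Set
Infinite X = (a : ℕ) → ∃[ b ] (a ≤ b × X b)

ColourOf : ∀ {k} → Colouring k → SubsetN → Fin k → Set
ColourOf Δ X c = ∃[ x ] ∃[ y ] (x < y × X x × X y × Δ x y ≡ c)

ExactlyColoured : ∀ {k} → Colouring k → ℕ → SubsetN → Set
ExactlyColoured {k} Δ m X =
  Σ (Subset k) λ S → ∣ S ∣ ≡ m × ((c : Fin k) → (c ∈ S) ⇔ ColourOf Δ X c)

InF : ∀ {k} → Colouring k → ℕ → Set₁
InF {k} Δ m = (1 ≤ m × m ≤ k) × Σ SubsetN λ X → Infinite X × ExactlyColoured Δ m X

AtLeastInF : ∀ {k} → Colouring k → ℕ → Set₁
AtLeastInF Δ n = Σ (Fin n → ℕ) λ f → Injective _≡_ _≡_ f × ((i : Fin n) → InF Δ (f i))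

-- Fix an edge of each colour and let A be the finite set of their endpoints. Ramsey's theorem
-- (with the infinite pigeonhole principle, which needs excluded middle) gives an infinite set Y
-- above A that is monochromatic of some colour ρ and such that each v ∈ A sends a single colour
-- d v to Y. For B ⊆ A the infinite set B ∪ Y then sees exactly ρ, the colours d v (v ∈ B) and
-- the colours of edges inside B; for B = A these are all k colours. So it suffices that these
-- colour counts take at least n values when A spans more than n C 2 colours. Take m maximal
-- with m C 2 < |colours A|. Some vertex loses at most m - 1 colours when deleted: otherwise
-- the lost sets, which miss ρ and pairwise share at most the colour of one edge, would hold
-- m + (m - 1) + ... colours, more than A can span. Deleting that vertex either loses nothing,
-- or leaves more than (m - 1) C 2 colours and yields m - 1 further, smaller values by induction.

module Submission where

open import Defs
open import Level using (0ℓ)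
open import Axiom.ExcludedMiddle using (ExcludedMiddle)
open import Data.Nat using (ℕ; suc; _+_; _≤_; _<_)
open import Data.Nat.Combinatorics using (_C_)

open import Data.Nat
open import Data.Nat.Properties
open import Data.Nat.Combinatorics using (nCk+nC[k+1]≡[n+1]C[k+1]; nC1≡n)
open import Data.Nat.Induction using (<-wellFounded)
open import Algebra.Properties.CommutativeSemigroup +-commutativeSemigroup using (x∙yz≈y∙xz)
open import Data.Bool using (true; false)
open import Data.Vec using (_∷_; [])
open import Data.Fin using (Fin; zero; suc; inject≤)
open import Data.Fin.Properties using (inject≤-injective)
open import Data.Fin.Subset renaming (⊥ to ∅)
open import Data.Fin.Subset.Properties
open import Data.List using (List; []; _∷_; length; filter; map; lookup; tabulate; _++_; deduplicate)
open import Data.List.Membership.Propositional using (find; lose) renaming (_∈_ to _∈ₗ_)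
open import Data.List.Membership.Propositional.Properties
  using (∈-filter⁺; ∈-filter⁻; ∈-lookup; ∈-tabulate⁺; ∈-++⁺ˡ; ∈-++⁺ʳ; ∈-deduplicate⁺)
open import Data.List.Relation.Binary.Subset.Propositional using () renaming (_⊆_ to _⊆ₗ_)
open import Data.List.Relation.Unary.Any using (Any; here; there; any?)
import Data.List.Relation.Unary.Any as Any
open import Data.List.Relation.Unary.All as All using (All; []; _∷_)
open import Data.List.Relation.Unary.AllPairs using ([]; _∷_)
open import Data.List.Relation.Unary.Unique.Propositional using (Unique)
open import Data.List.Relation.Unary.Unique.Propositional.Properties using (Unique[x∷xs]⇒x∉xs; filter⁺)
open import Data.List.Relation.Unary.Unique.DecPropositional.Properties _≟_ using (deduplicate-!)
open import Data.List.Properties using (filter-notAll)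
open import Data.Product using (Σ; ∃-syntax; _×_; _,_; proj₁; proj₂; map₂)
open import Data.Sum using (_⊎_; inj₁; inj₂)
open import Data.Unit using (tt) renaming (⊤ to Unit)
open import Data.Empty using (⊥-elim)
open import Relation.Nullary using (¬_; ¬?; yes; no; contradiction)
open import Relation.Binary.Definitions using (tri<; tri≈; tri>)
open import Relation.Binary.PropositionalEquality
open import Function using (_∘_; id)
open import Function.Bundles using (mk⇔)
open import Function.Definitions using (Injective)
open import Induction.WellFounded using (Acc; acc)

[1+n]C2≡n+nC2 : ∀ n → suc n C 2 ≡ n + n C 2
[1+n]C2≡n+nC2 n = trans (sym (nCk+nC[k+1]≡[n+1]C[k+1] n 1)) (cong (_+ n C 2) (nC1≡n n))

2≤n⇒1≤nC2 : ∀ {n} → 2 ≤ n → 1 ≤ n C 2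
2≤n⇒1≤nC2 {suc (suc n)} (s≤s (s≤s z≤n)) = begin
  1                     ≤⟨ s≤s z≤n ⟩
  suc n + suc n C 2     ≡⟨ [1+n]C2≡n+nC2 (suc n) ⟨
  suc (suc n) C 2       ∎
  where open ≤-Reasoning

n≤[1+n]C2 : ∀ n → n ≤ suc n C 2
n≤[1+n]C2 n = ≤-trans (m≤m+n n (n C 2)) (≤-reflexive (sym ([1+n]C2≡n+nC2 n)))

C2-bracket : ∀ {n K} → n C 2 < K → ∃[ m ] (n ≤ m × m C 2 < K × K ≤ suc m C 2)
C2-bracket {n} {K} = search K (m≤n+m K n)
  where
  search : ∀ fuel {n} → K ≤ n + fuel → n C 2 < K → ∃[ m ] (n ≤ m × m C 2 < K × K ≤ suc m C 2)
  search fuel {n} _ nC2<K with K ≤? suc n C 2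
  ... | yes K≤[1+n]C2 = n , ≤-refl , nC2<K , K≤[1+n]C2
  search zero {n} K≤n+0 _ | no K≰[1+n]C2 =
    contradiction (≤-trans (subst (K ≤_) (+-identityʳ n) K≤n+0) (n≤[1+n]C2 n)) K≰[1+n]C2
  search (suc fuel) {n} K≤n+1+fuel _ | no K≰[1+n]C2
    with search fuel (subst (K ≤_) (+-suc n fuel) K≤n+1+fuel) (≰⇒> K≰[1+n]C2)
  ... | m , 1+n≤m , bracket = m , ≤-trans (n≤1+n n) 1+n≤m , bracket

countdownSum : ℕ → ℕ → ℕ
countdownSum n zero    = zero
countdownSum n (suc a) = n ∸ a + countdownSum n a

countdownSum-monoˡ-≤ : ∀ {n n′} a → n ≤ n′ → countdownSum n a ≤ countdownSum n′ a
countdownSum-monoˡ-≤ zero    n≤n′ = z≤n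
countdownSum-monoˡ-≤ (suc a) n≤n′ = +-mono-≤ (∸-monoˡ-≤ a n≤n′) (countdownSum-monoˡ-≤ a n≤n′)

countdownSum-monoʳ-≤ : ∀ n {a a′} → a ≤ a′ → countdownSum n a ≤ countdownSum n a′
countdownSum-monoʳ-≤ n {a} {a′} a≤a′ with m≤n⇒m<n∨m≡n a≤a′
... | inj₂ refl = ≤-refl
countdownSum-monoʳ-≤ n {a} {suc a′} a≤a′ | inj₁ a<1+a′ =
  ≤-trans (countdownSum-monoʳ-≤ n (≤-pred a<1+a′)) (m≤n+m _ (n ∸ a′))

countdownSum-suc : ∀ n a → a ≤ n → countdownSum (suc n) a ≡ a + countdownSum n a
countdownSum-suc n zero    _   = refl
countdownSum-suc n (suc a) a<n = begin
  suc n ∸ a + countdownSum (suc n) a   ≡⟨ cong₂ _+_ (+-∸-assoc 1 a≤n) (countdownSum-suc n a a≤n) ⟩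
  suc (n ∸ a) + (a + countdownSum n a) ≡⟨ cong suc (x∙yz≈y∙xz (n ∸ a) a (countdownSum n a)) ⟩
  suc a + (n ∸ a + countdownSum n a)   ∎
  where
  open ≡-Reasoning
  a≤n = ≤-trans (n≤1+n a) a<n

countdownSum-diag : ∀ n → countdownSum n n ≡ suc n C 2
countdownSum-diag zero    = refl
countdownSum-diag (suc n) = begin
  suc n ∸ n + countdownSum (suc n) n ≡⟨ cong₂ _+_ (m+n∸n≡m 1 n) (countdownSum-suc n n ≤-refl) ⟩
  suc (n + countdownSum n n)         ≡⟨ cong (λ s → suc (n + s)) (countdownSum-diag n) ⟩
  suc (n + suc n C 2)                ≡⟨ [1+n]C2≡n+nC2 (suc n) ⟨
  suc (suc n) C 2                    ∎
  where open ≡-Reasoning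

countdownSum-≥ : ∀ {n K} a → 2 ≤ n → n C 2 < K → K ≤ suc n C 2 → K ≤ suc (suc a C 2) →
                 K ≤ countdownSum n a
countdownSum-≥ {n} {K} a 2≤n nC2<K K≤[1+n]C2 K≤1+[1+a]C2 with n ≤? a
... | yes n≤a = begin
  K                  ≤⟨ K≤[1+n]C2 ⟩
  suc n C 2          ≡⟨ countdownSum-diag n ⟨
  countdownSum n n   ≤⟨ countdownSum-monoʳ-≤ n n≤a ⟩
  countdownSum n a   ∎
  where open ≤-Reasoning
countdownSum-≥ {n} {K} zero 2≤n nC2<K _ K≤1 | no _ =
  ⊥-elim (≤⇒≯ K≤1 (≤-<-trans (2≤n⇒1≤nC2 2≤n) nC2<K))
countdownSum-≥ {n} {K} (suc a) _ _ _ K≤1+[2+a]C2 | no n≰1+a = begin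
  K                                      ≤⟨ K≤1+[2+a]C2 ⟩
  suc (suc (suc a) C 2)                  ≤⟨ +-monoˡ-≤ _ (s≤s z≤n) ⟩
  suc a + suc (suc a) C 2                ≡⟨ cong (suc a +_) (countdownSum-diag (suc a)) ⟨
  suc a + countdownSum (suc a) (suc a)   ≡⟨ countdownSum-suc (suc a) (suc a) ≤-refl ⟨
  countdownSum (suc (suc a)) (suc a)     ≤⟨ countdownSum-monoˡ-≤ (suc a) (≰⇒> n≰1+a) ⟩
  countdownSum n (suc a)                 ∎
  where open ≤-Reasoning

m+n≤p+o⇒m∸o+n≤p : ∀ {m n o p} → m + n ≤ p + o → n ≤ p → m ∸ o + n ≤ p
m+n≤p+o⇒m∸o+n≤p {m} {n} {o} {p} m+n≤p+o n≤p with m ≤? o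
... | yes m≤o = subst (_≤ p) (cong (_+ n) (sym (m≤n⇒m∸n≡0 m≤o))) n≤p
... | no m≰o  = begin
  m ∸ o + n     ≡⟨ +-∸-comm n o≤m ⟨
  m + n ∸ o     ≤⟨ ∸-monoˡ-≤ o m+n≤p+o ⟩
  p + o ∸ o     ≡⟨ m+n∸n≡m p o ⟩
  p             ∎
  where
  open ≤-Reasoning
  o≤m = <⇒≤ (≰⇒> m≰o)

[1+m]C2<K≤K′+m⇒mC2<K′ : ∀ {m K K′} → suc m C 2 < K → K ≤ K′ + m → m C 2 < K′
[1+m]C2<K≤K′+m⇒mC2<K′ {m} {K} {K′} lo K≤K′+m = +-cancelʳ-< m (m C 2) K′ (begin-strict
  m C 2 + m   ≡⟨ +-comm (m C 2) m ⟩
  m + m C 2   ≡⟨ [1+n]C2≡n+nC2 m ⟨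
  suc m C 2   <⟨ lo ⟩
  K           ≤⟨ K≤K′+m ⟩
  K′ + m      ∎)
  where open ≤-Reasoning

_⊆ᴺ_ : SubsetN → SubsetN → Set
X ⊆ᴺ Z = ∀ {y} → X y → Z y

Monochromatic : ∀ {k} → Colouring k → SubsetN → Fin k → Set
Monochromatic Δ Y ρ = ∀ {x y} → Y x → Y y → x < y → Δ x y ≡ ρ

ConstantTo : ∀ {k} → Colouring k → ℕ → SubsetN → Fin k → Set
ConstantTo Δ v Y c = ∀ {y} → Y y → v < y × Δ v y ≡ c

Infinite-above : ∀ {Z} → Infinite Z → ∀ v → Infinite (λ y → Z y × v < y)
Infinite-above inf v a with inf (suc v ⊔ a)
... | b , v⊔a≤b , Zb = b , ≤-trans (m≤n⊔m (suc v) a) v⊔a≤b , Zb , ≤-trans (m≤m⊔n (suc v) a) v⊔a≤b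

Fin-bounded : ∀ {k} (f : Fin k → ℕ) → ∃[ M ] (∀ c → f c ≤ M)
Fin-bounded {zero}  f = 0 , λ ()
Fin-bounded {suc k} f with Fin-bounded (f ∘ suc)
... | M , f∘suc≤M = f zero ⊔ M , λ where
  zero    → m≤m⊔n (f zero) M
  (suc c) → ≤-trans (f∘suc≤M c) (m≤n⊔m (f zero) M)

module Classical (em : ExcludedMiddle 0ℓ) where

  ¬Infinite⇒bounded : ∀ {X} → ¬ Infinite X → ∃[ a ] (∀ {b} → a ≤ b → ¬ X b)
  ¬Infinite⇒bounded {X} ¬inf with em {∃[ a ] (∀ {b} → a ≤ b → ¬ X b)}
  ... | yes bounded = bounded
  ... | no ¬bounded = ⊥-elim (¬inf inf)
    where
    inf : Infinite X
    inf a with em {∃[ b ] (a ≤ b × X b)}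
    ... | yes witness = witness
    ... | no ¬witness = ⊥-elim (¬bounded (a , λ a≤b Xb → ¬witness (_ , a≤b , Xb)))

  infinite-pigeonhole : ∀ {k Z} → Infinite Z → (h : ℕ → Fin k) →
                        ∃[ c ] Infinite (λ y → Z y × h y ≡ c)
  infinite-pigeonhole {k} {Z} inf h with em {∃[ c ] Infinite (λ y → Z y × h y ≡ c)}
  ... | yes p = p
  ... | no ¬p = ⊥-elim (bounded (Fin-bounded (λ c → proj₁ (bound c))))
    where
    bound : ∀ c → ∃[ a ] (∀ {b} → a ≤ b → ¬ (Z b × h b ≡ c))
    bound c = ¬Infinite⇒bounded (λ inf-c → ¬p (c , inf-c))
    bounded : ¬ (∃[ M ] (∀ c → proj₁ (bound c) ≤ M))
    bounded (M , bound≤M) with inf M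
    ... | b , M≤b , Zb = proj₂ (bound (h b)) (≤-trans (bound≤M (h b)) M≤b) (Zb , refl)

  module _ {k} (Δ : Colouring k) where

    record Refinement (v : ℕ) (Z : SubsetN) : Set₁ where
      field
        colour   : Fin k
        set      : SubsetN
        infinite : Infinite set
        ⊆Z       : set ⊆ᴺ Z
        constant : ConstantTo Δ v set colour

    refine : ∀ v {Z} → Infinite Z → Refinement v Z
    refine v {Z} inf = record
      { colour   = c
      ; set      = λ y → (Z y × v < y) × Δ v y ≡ c
      ; infinite = inf-c
      ; ⊆Z       = proj₁ ∘ proj₁
      ; constant = λ ((_ , v<y) , Δvy≡c) → v<y , Δvy≡c
      }
      where
      open Σ (infinite-pigeonhole (Infinite-above inf v) (Δ v)) renaming (proj₁ to c; proj₂ to inf-c)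

    endHomogenise : ∀ A {Z} → Infinite Z →
                    ∃[ Y ] (Infinite Y × Y ⊆ᴺ Z × All (λ v → ∃[ c ] ConstantTo Δ v Y c) A)
    endHomogenise []      {Z} inf = Z , inf , (λ Zy → Zy) , []
    endHomogenise (v ∷ A)     inf =
      let open Refinement (refine v inf)
          Y , inf-Y , Y⊆ , consts = endHomogenise A infinite
      in  Y , inf-Y , ⊆Z ∘ Y⊆ , (colour , constant ∘ Y⊆) ∷ consts

    module RamseySequence {Z} (inf : Infinite Z) where

      first : Σ SubsetN Infinite → ℕ
      first (_ , inf-S) = proj₁ (inf-S 0)

      next : (S : Σ SubsetN Infinite) → Refinement (first S) (proj₁ S)
      next (_ , inf-S) = refine _ inf-S

      stage : ℕ → Σ SubsetN Infinite
      stage zero    = Z , inf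
      stage (suc i) = Refinement.set (next (stage i)) , Refinement.infinite (next (stage i))

      W : ℕ → SubsetN
      W i = proj₁ (stage i)

      x : ℕ → ℕ
      x i = first (stage i)

      c : ℕ → Fin k
      c i = Refinement.colour (next (stage i))

      x∈W : ∀ i → W i (x i)
      x∈W i = proj₂ (proj₂ (proj₂ (stage i) 0))

      W⊆Z : ∀ i → W i ⊆ᴺ Z
      W⊆Z zero    = λ Zy → Zy
      W⊆Z (suc i) = W⊆Z i ∘ Refinement.⊆Z (next (stage i))

      W-shrink : ∀ {i j} → i < j → W j ⊆ᴺ W (suc i)
      W-shrink {i} {suc j} i<1+j with m≤n⇒m<n∨m≡n (≤-pred i<1+j)
      ... | inj₂ refl = λ Wy → Wy
      ... | inj₁ i<j  = W-shrink i<j ∘ Refinement.⊆Z (next (stage j))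

      x-edge : ∀ {i j} → i < j → x i < x j × Δ (x i) (x j) ≡ c i
      x-edge {i} {j} i<j = Refinement.constant (next (stage i)) (W-shrink i<j (x∈W j))

      i≤x : ∀ i → i ≤ x i
      i≤x zero    = z≤n
      i≤x (suc i) = ≤-trans (s≤s (i≤x i)) (proj₁ (x-edge (n<1+n i)))

    infinite-ramsey : ∀ {Z} → Infinite Z → ∃[ ρ ] ∃[ Y ] (Infinite Y × Y ⊆ᴺ Z × Monochromatic Δ Y ρ)
    infinite-ramsey {Z} inf = ρ , Y , inf-Y , Y⊆Z , mono
      where
      open RamseySequence inf
      open Σ (infinite-pigeonhole {Z = λ _ → Unit} (λ a → a , ≤-refl , tt) c)
        renaming (proj₁ to ρ; proj₂ to inf-ρ)
      Y : SubsetN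
      Y y = ∃[ i ] (c i ≡ ρ × y ≡ x i)
      inf-Y : Infinite Y
      inf-Y a with inf-ρ a
      ... | i , a≤i , _ , cᵢ≡ρ = x i , ≤-trans a≤i (i≤x i) , i , cᵢ≡ρ , refl
      Y⊆Z : Y ⊆ᴺ Z
      Y⊆Z (i , _ , refl) = W⊆Z i (x∈W i)
      mono : Monochromatic Δ Y ρ
      mono (i , cᵢ≡ρ , refl) (j , _ , refl) xᵢ<xⱼ with <-cmp i j
      ... | tri< i<j _ _ = trans (proj₂ (x-edge i<j)) cᵢ≡ρ
      ... | tri≈ _ refl _ = ⊥-elim (<-irrefl refl xᵢ<xⱼ)
      ... | tri> _ _ j<i = ⊥-elim (<-asym xᵢ<xⱼ (proj₁ (x-edge j<i)))

    homogeneousConfiguration : ∀ A → ∃[ ρ ] ∃[ Y ] (Infinite Y × Monochromatic Δ Y ρ ×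
                                                   All (λ v → ∃[ c ] ConstantTo Δ v Y c) A)
    homogeneousConfiguration A =
      let Y₀ , inf-Y₀ , _ , consts = endHomogenise A {Z = λ _ → Unit} (λ a → a , ≤-refl , tt)
          ρ , Y , inf-Y , Y⊆Y₀ , mono = infinite-ramsey inf-Y₀
      in  ρ , Y , inf-Y , mono , All.map (λ (c , const) → c , λ {y} Yy → const (Y⊆Y₀ Yy)) consts

∣p∪q∣+∣p∩q∣≡∣p∣+∣q∣ : ∀ {n} (p q : Subset n) → ∣ p ∪ q ∣ + ∣ p ∩ q ∣ ≡ ∣ p ∣ + ∣ q ∣
∣p∪q∣+∣p∩q∣≡∣p∣+∣q∣ []          []          = refl
∣p∪q∣+∣p∩q∣≡∣p∣+∣q∣ (true ∷ p)  (true ∷ q)  =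
  cong suc (trans (+-suc _ _) (trans (cong suc (∣p∪q∣+∣p∩q∣≡∣p∣+∣q∣ p q)) (sym (+-suc _ _))))
∣p∪q∣+∣p∩q∣≡∣p∣+∣q∣ (true ∷ p)  (false ∷ q) = cong suc (∣p∪q∣+∣p∩q∣≡∣p∣+∣q∣ p q)
∣p∪q∣+∣p∩q∣≡∣p∣+∣q∣ (false ∷ p) (true ∷ q)  = trans (cong suc (∣p∪q∣+∣p∩q∣≡∣p∣+∣q∣ p q)) (sym (+-suc _ _))
∣p∪q∣+∣p∩q∣≡∣p∣+∣q∣ (false ∷ p) (false ∷ q) = ∣p∪q∣+∣p∩q∣≡∣p∣+∣q∣ p q

∣p∪q∣≤∣p∣+∣q∣ : ∀ {n} (p q : Subset n) → ∣ p ∪ q ∣ ≤ ∣ p ∣ + ∣ q ∣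
∣p∪q∣≤∣p∣+∣q∣ p q = ≤-trans (m≤m+n _ _) (≤-reflexive (∣p∪q∣+∣p∩q∣≡∣p∣+∣q∣ p q))

delete : ℕ → List ℕ → List ℕ
delete v = filter (λ x → ¬? (x ≟ v))

∈-delete⁺ : ∀ {v x A} → x ∈ₗ A → x ≢ v → x ∈ₗ delete v A
∈-delete⁺ {v} = ∈-filter⁺ (λ x → ¬? (x ≟ v))

delete-⊆ : ∀ {v A} → delete v A ⊆ₗ A
delete-⊆ {v} {A} = proj₁ ∘ ∈-filter⁻ (λ x → ¬? (x ≟ v)) {xs = A}

delete-unique : ∀ {v A} → Unique A → Unique (delete v A)
delete-unique {v} = filter⁺ (λ x → ¬? (x ≟ v))

length-delete< : ∀ {v A} → v ∈ₗ A → length (delete v A) < length A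
length-delete< {v} {A} v∈A = filter-notAll (λ x → ¬? (x ≟ v)) A (Any.map (λ { refl v≢v → v≢v refl }) v∈A)

-- colours B stands for Δ((B ∪ Y)^(2)), where Δ is ρ on the infinite set Y, each v ∈ B sends
-- the single colour d v to Y, and e is Δ on unordered pairs.
module ColourSets {k} (ρ : Fin k) (d : ℕ → Fin k) (e : ℕ → ℕ → Fin k)
                  (e-comm : ∀ x y → e x y ≡ e y x) where

  edgeColours : ℕ → List ℕ → Subset k
  edgeColours v []      = ∅
  edgeColours v (u ∷ B) = ⁅ e v u ⁆ ∪ edgeColours v B

  colours : List ℕ → Subset k
  colours []      = ⁅ ρ ⁆
  colours (v ∷ B) = (colours B ∪ ⁅ d v ⁆) ∪ edgeColours v B

  data Spanned (B : List ℕ) : Fin k → Set where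
    root   : Spanned B ρ
    vertex : ∀ {x} → x ∈ₗ B → Spanned B (d x)
    edge   : ∀ {x y} → x ∈ₗ B → y ∈ₗ B → x ≢ y → Spanned B (e x y)

  ∣edgeColours∣≤length : ∀ v B → ∣ edgeColours v B ∣ ≤ length B
  ∣edgeColours∣≤length v []      = ≤-reflexive (∣⊥∣≡0 k)
  ∣edgeColours∣≤length v (u ∷ B) = begin
    ∣ ⁅ e v u ⁆ ∪ edgeColours v B ∣       ≤⟨ ∣p∪q∣≤∣p∣+∣q∣ ⁅ e v u ⁆ (edgeColours v B) ⟩
    ∣ ⁅ e v u ⁆ ∣ + ∣ edgeColours v B ∣   ≡⟨ cong (_+ ∣ edgeColours v B ∣) (∣⁅x⁆∣≡1 (e v u)) ⟩
    suc ∣ edgeColours v B ∣               ≤⟨ s≤s (∣edgeColours∣≤length v B) ⟩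
    suc (length B)                        ∎
    where open ≤-Reasoning

  ∣colours∣≤ : ∀ B → ∣ colours B ∣ ≤ suc (suc (length B) C 2)
  ∣colours∣≤ []      = ≤-reflexive (∣⁅x⁆∣≡1 ρ)
  ∣colours∣≤ (v ∷ B) = begin
    ∣ (colours B ∪ ⁅ d v ⁆) ∪ edgeColours v B ∣     ≤⟨ ∣p∪q∣≤∣p∣+∣q∣ (colours B ∪ ⁅ d v ⁆) _ ⟩
    ∣ colours B ∪ ⁅ d v ⁆ ∣ + ∣ edgeColours v B ∣   ≤⟨ +-mono-≤ (∣p∪q∣≤∣p∣+∣q∣ (colours B) _) (∣edgeColours∣≤length v B) ⟩
    ∣ colours B ∣ + ∣ ⁅ d v ⁆ ∣ + b                 ≡⟨ cong (λ s → ∣ colours B ∣ + s + b) (∣⁅x⁆∣≡1 (d v)) ⟩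
    ∣ colours B ∣ + 1 + b                           ≤⟨ +-monoˡ-≤ b (+-monoˡ-≤ 1 (∣colours∣≤ B)) ⟩
    suc (suc b C 2) + 1 + b                         ≡⟨ cong (_+ b) (+-comm _ 1) ⟩
    suc (suc (suc b C 2)) + b                       ≡⟨ cong suc (+-comm _ b) ⟩
    suc (b + suc (suc b C 2))                       ≡⟨ cong suc (+-suc b _) ⟩
    suc (suc b + suc b C 2)                         ≡⟨ cong suc ([1+n]C2≡n+nC2 (suc b)) ⟨
    suc (suc (suc b) C 2)                           ∎
    where
    open ≤-Reasoning
    b = length B

  edgeColours⁺ : ∀ {v u B} → u ∈ₗ B → e v u ∈ edgeColours v B
  edgeColours⁺ {v} {B = _ ∷ B} (here refl) = p⊆p∪q (edgeColours v B) (x∈⁅x⁆ _)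
  edgeColours⁺ {v} {B = w ∷ B} (there u∈B) = q⊆p∪q ⁅ e v w ⁆ (edgeColours v B) (edgeColours⁺ u∈B)

  edgeColours⁻ : ∀ v B {c} → c ∈ edgeColours v B → ∃[ u ] (u ∈ₗ B × c ≡ e v u)
  edgeColours⁻ v []      c∈ = contradiction c∈ ∉⊥
  edgeColours⁻ v (u ∷ B) c∈ with x∈p∪q⁻ ⁅ e v u ⁆ (edgeColours v B) c∈
  ... | inj₁ c∈⁅evu⁆ = u , here refl , x∈⁅y⁆⇒x≡y _ c∈⁅evu⁆
  ... | inj₂ c∈E with edgeColours⁻ v B c∈E
  ...   | w , w∈B , c≡evw = w , there w∈B , c≡evw

  colours-∷ : ∀ v B → colours B ⊆ colours (v ∷ B)
  colours-∷ v B = p⊆p∪q (edgeColours v B) ∘ p⊆p∪q ⁅ d v ⁆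

  colours-complete : ∀ {B c} → Spanned B c → c ∈ colours B
  colours-complete {[]}    root = x∈⁅x⁆ ρ
  colours-complete {v ∷ B} root = colours-∷ v B (colours-complete {B} root)
  colours-complete {v ∷ B} (vertex (here refl)) =
    p⊆p∪q (edgeColours v B) (q⊆p∪q (colours B) ⁅ d v ⁆ (x∈⁅x⁆ (d v)))
  colours-complete {v ∷ B} (vertex (there x∈B)) = colours-∷ v B (colours-complete (vertex x∈B))
  colours-complete (edge (here refl) (here refl) x≢y) = contradiction refl x≢y
  colours-complete {v ∷ B} (edge (here refl) (there y∈B) _) =
    q⊆p∪q (colours B ∪ ⁅ d v ⁆) (edgeColours v B) (edgeColours⁺ y∈B)
  colours-complete {v ∷ B} (edge (there x∈B) (here refl) _) =
    subst (_∈ colours (v ∷ B)) (e-comm v _) (q⊆p∪q (colours B ∪ ⁅ d v ⁆) (edgeColours v B) (edgeColours⁺ x∈B))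
  colours-complete {v ∷ B} (edge (there x∈B) (there y∈B) x≢y) =
    colours-∷ v B (colours-complete (edge x∈B y∈B x≢y))

  Spanned-∷ : ∀ {v B c} → Spanned B c → Spanned (v ∷ B) c
  Spanned-∷ root                 = root
  Spanned-∷ (vertex x∈B)         = vertex (there x∈B)
  Spanned-∷ (edge x∈B y∈B x≢y)   = edge (there x∈B) (there y∈B) x≢y

  -- Uniqueness of B rules out the colour e v v.
  colours-sound : ∀ {B c} → Unique B → c ∈ colours B → Spanned B c
  colours-sound {[]}    _              c∈ with refl ← x∈⁅y⁆⇒x≡y ρ c∈ = root
  colours-sound {v ∷ B} B!@(_ ∷ B′!) c∈ with x∈p∪q⁻ (colours B ∪ ⁅ d v ⁆) (edgeColours v B) c∈
  ... | inj₂ c∈E with edgeColours⁻ v B c∈E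
  ...   | u , u∈B , refl = edge (here refl) (there u∈B) λ { refl → Unique[x∷xs]⇒x∉xs B! u∈B }
  colours-sound {v ∷ B} (_ ∷ B′!) c∈ | inj₁ c∈T∪d with x∈p∪q⁻ (colours B) ⁅ d v ⁆ c∈T∪d
  ... | inj₁ c∈T         = Spanned-∷ (colours-sound B′! c∈T)
  ... | inj₂ c∈⁅dv⁆ with refl ← x∈⁅y⁆⇒x≡y _ c∈⁅dv⁆ = vertex (here refl)

  Spanned-mono : ∀ {B A c} → B ⊆ₗ A → Spanned B c → Spanned A c
  Spanned-mono B⊆A root               = root
  Spanned-mono B⊆A (vertex x∈B)       = vertex (B⊆A x∈B)
  Spanned-mono B⊆A (edge x∈B y∈B x≢y) = edge (B⊆A x∈B) (B⊆A y∈B) x≢y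

  colours-mono : ∀ {B A} → Unique B → B ⊆ₗ A → colours B ⊆ colours A
  colours-mono B! B⊆A = colours-complete ∘ Spanned-mono B⊆A ∘ colours-sound B!

  lost : List ℕ → ℕ → Subset k
  lost A v = colours A ∩ ∁ (colours (delete v A))

  lost⁻ : ∀ {A v c} → c ∈ lost A v → c ∈ colours A × c ∉ colours (delete v A)
  lost⁻ {A} c∈ with x∈p∩q⁻ (colours A) _ c∈
  ... | c∈T , c∈∁ = c∈T , x∈∁p⇒x∉p c∈∁

  ∣colours∣≤∣colours-delete∣+∣lost∣ : ∀ A v → ∣ colours A ∣ ≤ ∣ colours (delete v A) ∣ + ∣ lost A v ∣
  ∣colours∣≤∣colours-delete∣+∣lost∣ A v =
    ≤-trans (p⊆q⇒∣p∣≤∣q∣ split) (∣p∪q∣≤∣p∣+∣q∣ (colours (delete v A)) (lost A v))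
    where
    split : colours A ⊆ colours (delete v A) ∪ lost A v
    split {c} c∈T with c ∈? colours (delete v A)
    ... | yes c∈T′ = p⊆p∪q (lost A v) c∈T′
    ... | no  c∉T′ = q⊆p∪q (colours (delete v A)) (lost A v) (x∈p∩q⁺ (c∈T , x∉p⇒x∈∁p c∉T′))

  lost-endpoint : ∀ {A v x y} → x ∈ₗ A → y ∈ₗ A → x ≢ y →
                  e x y ∉ colours (delete v A) → x ≡ v ⊎ y ≡ v
  lost-endpoint {v = v} {x} {y} x∈A y∈A x≢y exy∉ with x ≟ v | y ≟ v
  ... | yes x≡v | _       = inj₁ x≡v
  ... | no _    | yes y≡v = inj₂ y≡v
  ... | no x≢v  | no y≢v  =
    contradiction (colours-complete (edge (∈-delete⁺ x∈A x≢v) (∈-delete⁺ y∈A y≢v) x≢y)) exy∉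

  lost-shared : ∀ {A w u c} → Unique A → w ≢ u → c ∈ lost A w → c ∈ lost A u → c ≡ e w u
  lost-shared {A} {w} {u} A! w≢u c∈Lw c∈Lu
    with lost⁻ {A} {w} c∈Lw | lost⁻ {A} {u} c∈Lu
  ... | c∈T , c∉T-w | _ , c∉T-u with colours-sound A! c∈T
  ... | root = contradiction (colours-complete {delete w A} root) c∉T-w
  ... | vertex {x} x∈A with x ≟ w
  ...   | no x≢w  = contradiction (colours-complete (vertex (∈-delete⁺ x∈A x≢w))) c∉T-w
  ...   | yes refl = contradiction (colours-complete (vertex (∈-delete⁺ x∈A w≢u))) c∉T-u
  lost-shared {A} {w} {u} A! w≢u c∈Lw c∈Lu | _ , c∉T-w | _ , c∉T-u | edge x∈A y∈A x≢y
    with lost-endpoint x∈A y∈A x≢y c∉T-w | lost-endpoint x∈A y∈A x≢y c∉T-u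
  ... | inj₁ refl | inj₁ refl = contradiction refl w≢u
  ... | inj₁ refl | inj₂ refl = refl
  ... | inj₂ refl | inj₁ refl = e-comm u w
  ... | inj₂ refl | inj₂ refl = contradiction refl w≢u

  lostUnion : List ℕ → List ℕ → Subset k
  lostUnion A l = ⋃ (map (lost A) l)

  lostUnion⁻ : ∀ A l {c} → c ∈ lostUnion A l → ∃[ u ] (u ∈ₗ l × c ∈ lost A u)
  lostUnion⁻ A []      c∈ = contradiction c∈ ∉⊥
  lostUnion⁻ A (v ∷ l) c∈ with x∈p∪q⁻ (lost A v) (lostUnion A l) c∈
  ... | inj₁ c∈Lv = v , here refl , c∈Lv
  ... | inj₂ c∈U with lostUnion⁻ A l c∈U
  ...   | u , u∈l , c∈Lu = u , there u∈l , c∈Lu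

  lostUnion⊂colours : ∀ A l → lostUnion A l ⊂ colours A
  lostUnion⊂colours A l = U⊆T , ρ , colours-complete {A} root , ρ∉U
    where
    U⊆T : lostUnion A l ⊆ colours A
    U⊆T c∈U with lostUnion⁻ A l c∈U
    ... | u , _ , c∈Lu = proj₁ (lost⁻ {A} {u} c∈Lu)
    ρ∉U : ρ ∉ lostUnion A l
    ρ∉U ρ∈U with lostUnion⁻ A l ρ∈U
    ... | u , _ , ρ∈Lu = proj₂ (lost⁻ {A} {u} ρ∈Lu) (colours-complete {delete u A} root)

  -- Vertex number i of l adds at least n ∸ i new lost colours, by lost-shared.
  countdownSum≤∣lostUnion∣ : ∀ {A n} → Unique A → (∀ {v} → v ∈ₗ A → n ≤ ∣ lost A v ∣) →
                             ∀ l → Unique l → l ⊆ₗ A → countdownSum n (length l) ≤ ∣ lostUnion A l ∣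
  countdownSum≤∣lostUnion∣ _ _ [] _ _ = z≤n
  countdownSum≤∣lostUnion∣ {A} {n} A! n≤∣lost∣ (w ∷ l) w∷l!@(_ ∷ l!) w∷l⊆A =
    m+n≤p+o⇒m∸o+n≤p n+G≤ (≤-trans G≤∣U∣ (∣q∣≤∣p∪q∣ (lost A w) (lostUnion A l)))
    where
    G≤∣U∣ = countdownSum≤∣lostUnion∣ A! n≤∣lost∣ l l! (w∷l⊆A ∘ there)
    overlap⊆edgeColours : lost A w ∩ lostUnion A l ⊆ edgeColours w l
    overlap⊆edgeColours c∈ with x∈p∩q⁻ (lost A w) (lostUnion A l) c∈
    ... | c∈Lw , c∈U with lostUnion⁻ A l c∈U
    ...   | u , u∈l , c∈Lu =
      subst (_∈ edgeColours w l)
            (sym (lost-shared A! (λ { refl → Unique[x∷xs]⇒x∉xs w∷l! u∈l }) c∈Lw c∈Lu))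
            (edgeColours⁺ u∈l)
    n+G≤ : n + countdownSum n (length l) ≤ ∣ lostUnion A (w ∷ l) ∣ + length l
    n+G≤ = begin
      n + countdownSum n (length l)                          ≤⟨ +-mono-≤ (n≤∣lost∣ (w∷l⊆A (here refl))) G≤∣U∣ ⟩
      ∣ lost A w ∣ + ∣ lostUnion A l ∣                       ≡⟨ ∣p∪q∣+∣p∩q∣≡∣p∣+∣q∣ (lost A w) _ ⟨
      ∣ lostUnion A (w ∷ l) ∣ + ∣ lost A w ∩ lostUnion A l ∣ ≤⟨ +-monoʳ-≤ _ (p⊆q⇒∣p∣≤∣q∣ overlap⊆edgeColours) ⟩
      ∣ lostUnion A (w ∷ l) ∣ + ∣ edgeColours w l ∣          ≤⟨ +-monoʳ-≤ _ (∣edgeColours∣≤length w l) ⟩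
      ∣ lostUnion A (w ∷ l) ∣ + length l                     ∎
      where open ≤-Reasoning

  cheap-vertex : ∀ {A m} → Unique A → 2 ≤ suc m → suc m C 2 < ∣ colours A ∣ →
                 ∣ colours A ∣ ≤ suc (suc m) C 2 →
                 Any (λ v → ∣ colours A ∣ ≤ ∣ colours (delete v A) ∣ + m) A
  cheap-vertex {A} {m} A! 2≤1+m lo hi
    with any? (λ v → ∣ colours A ∣ ≤? ∣ colours (delete v A) ∣ + m) A
  ... | yes cheap = cheap
  ... | no ¬cheap =
    contradiction (countdownSum-≥ (length A) 2≤1+m lo hi (∣colours∣≤ A)) (<⇒≱ G<K)
    where
    expensive : ∀ {v} → v ∈ₗ A → suc m ≤ ∣ lost A v ∣
    expensive {v} v∈A = +-cancelˡ-< (∣ colours (delete v A) ∣) m (∣ lost A v ∣)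
      (<-≤-trans (≰⇒> (¬cheap ∘ lose v∈A)) (∣colours∣≤∣colours-delete∣+∣lost∣ A v))
    G<K : countdownSum (suc m) (length A) < ∣ colours A ∣
    G<K = ≤-<-trans (countdownSum≤∣lostUnion∣ A! expensive A A! id)
                    (p⊂q⇒∣p∣<∣q∣ (lostUnion⊂colours A A))

  Realised : List ℕ → ℕ → Set
  Realised A m = ∃[ B ] (Unique B × B ⊆ₗ A × ∣ colours B ∣ ≡ m)

  ManyRealised : List ℕ → ℕ → Set
  ManyRealised A n = ∃[ ms ] (Unique ms × n ≤ length ms × All (Realised A) ms)

  Realised-mono : ∀ {A′ A m} → A′ ⊆ₗ A → Realised A′ m → Realised A m
  Realised-mono A′⊆A (B , B! , B⊆A′ , refl) = B , B! , A′⊆A ∘ B⊆A′ , refl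

  Realised-≤ : ∀ {A m} → Realised A m → m ≤ ∣ colours A ∣
  Realised-≤ (B , B! , B⊆A , refl) = p⊆q⇒∣p∣≤∣q∣ (colours-mono B! B⊆A)

  ManyRealised-mono : ∀ {A′ A n n′} → A′ ⊆ₗ A → n ≤ n′ → ManyRealised A′ n′ → ManyRealised A n
  ManyRealised-mono A′⊆A n≤n′ (ms , ms! , n′≤ , reals) =
    ms , ms! , ≤-trans n≤n′ n′≤ , All.map (Realised-mono A′⊆A) reals

  ManyRealised-∷ : ∀ {A′ A n} → Unique A → A′ ⊆ₗ A → ∣ colours A′ ∣ < ∣ colours A ∣ →
                   ManyRealised A′ n → ManyRealised A (suc n)
  ManyRealised-∷ {A = A} A! A′⊆A K′<K (ms , ms! , n≤ , reals) =
    ∣ colours A ∣ ∷ ms , All.map (λ r → >⇒≢ (≤-<-trans (Realised-≤ r) K′<K)) reals ∷ ms! ,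
    s≤s n≤ , (A , A! , id , refl) ∷ All.map (Realised-mono A′⊆A) reals

  manyRealised : ∀ {A n} → Acc _<_ (length A) → Unique A → n C 2 < ∣ colours A ∣ → ManyRealised A n
  manyRealised {A} {n} _ A! _ with n ≤? 1
  ... | yes n≤1 = ∣ colours A ∣ ∷ [] , [] ∷ [] , n≤1 , (A , A! , id , refl) ∷ []
  manyRealised {A} {n} (acc rec) A! nC2<K | no n≰1 with C2-bracket nC2<K
  ... | zero  , n≤0 , _ = contradiction (≤-trans n≤0 z≤n) n≰1
  ... | suc m , n≤1+m , lo , hi with find (cheap-vertex A! (≤-trans (≰⇒> n≰1) n≤1+m) lo hi)
  ... | v , v∈A , K≤K′+m with ∣ colours A ∣ ≤? ∣ colours (delete v A) ∣
  ...   | yes K≤K′ = ManyRealised-mono delete-⊆ ≤-refl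
    (manyRealised (rec (length-delete< v∈A)) (delete-unique A!) (<-≤-trans nC2<K K≤K′))
  ...   | no K≰K′ = ManyRealised-mono id n≤1+m (ManyRealised-∷ A! delete-⊆ (≰⇒> K≰K′)
    (manyRealised (rec (length-delete< v∈A)) (delete-unique A!) ([1+m]C2<K≤K′+m⇒mC2<K′ lo K≤K′+m)))

lookup-injective : ∀ {a} {A : Set a} {xs : List A} → Unique xs → Injective _≡_ _≡_ (lookup xs)
lookup-injective {xs = _ ∷ _}  _            {zero}  {zero}  _  = refl
lookup-injective {xs = _ ∷ _}  (x∉xs ∷ _)   {zero}  {suc j} eq = contradiction eq (All.lookup x∉xs (∈-lookup j))
lookup-injective {xs = _ ∷ _}  (x∉xs ∷ _)   {suc i} {zero}  eq = contradiction (sym eq) (All.lookup x∉xs (∈-lookup i))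
lookup-injective {xs = _ ∷ _}  (_ ∷ xs!)    {suc i} {suc j} eq = cong suc (lookup-injective xs! eq)

AtLeastInF-fromList : ∀ {k} {Δ : Colouring k} {n} ms → Unique ms → n ≤ length ms → All (InF Δ) ms →
                      AtLeastInF Δ n
AtLeastInF-fromList ms ms! n≤ inFs =
  lookup ms ∘ (λ i → inject≤ i n≤) ,
  inject≤-injective n≤ n≤ _ _ ∘ lookup-injective ms! ,
  λ i → All.lookup inFs (∈-lookup _)

symmetrise : ∀ {k} → Colouring k → ℕ → ℕ → Fin k
symmetrise Δ x y = Δ (x ⊓ y) (x ⊔ y)

symmetrise-comm : ∀ {k} (Δ : Colouring k) x y → symmetrise Δ x y ≡ symmetrise Δ y x
symmetrise-comm Δ x y = cong₂ Δ (⊓-comm x y) (⊔-comm x y)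

symmetrise-< : ∀ {k} (Δ : Colouring k) {x y} → x < y → symmetrise Δ x y ≡ Δ x y
symmetrise-< Δ x<y = cong₂ Δ (m≤n⇒m⊓n≡m (<⇒≤ x<y)) (m≤n⇒m⊔n≡n (<⇒≤ x<y))

SpansAll : ∀ {k} → Colouring k → List ℕ → Set
SpansAll Δ A = ∀ c → ∃[ x ] ∃[ y ] (x ∈ₗ A × y ∈ₗ A × x < y × Δ x y ≡ c)

module Configuration {k} (Δ : Colouring k) {Y : SubsetN} (inf-Y : Infinite Y) {ρ : Fin k}
                     (mono : Monochromatic Δ Y ρ) {A : List ℕ}
                     (consts : All (λ v → ∃[ c ] ConstantTo Δ v Y c) A) where

  y₀ y₁ : ℕ
  y₀ = proj₁ (inf-Y 0)
  y₁ = proj₁ (inf-Y (suc y₀))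

  y₀∈Y : Y y₀
  y₀∈Y = proj₂ (proj₂ (inf-Y 0))

  y₁∈Y : Y y₁
  y₁∈Y = proj₂ (proj₂ (inf-Y (suc y₀)))

  y₀<y₁ : y₀ < y₁
  y₀<y₁ = proj₁ (proj₂ (inf-Y (suc y₀)))

  d : ℕ → Fin k
  d v = Δ v y₀

  const : ∀ {v} → v ∈ₗ A → ConstantTo Δ v Y (d v)
  const v∈A Yy with All.lookup consts v∈A
  ... | c , constᵥ = proj₁ (constᵥ Yy) , trans (proj₂ (constᵥ Yy)) (sym (proj₂ (constᵥ y₀∈Y)))

  open ColourSets ρ d (symmetrise Δ) (symmetrise-comm Δ)

  _∪Y : List ℕ → SubsetN
  (B ∪Y) x = x ∈ₗ B ⊎ Y x

  Spanned⇒ColourOf : ∀ {B c} → B ⊆ₗ A → Spanned B c → ColourOf Δ (B ∪Y) c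
  Spanned⇒ColourOf _ root = y₀ , y₁ , y₀<y₁ , inj₂ y₀∈Y , inj₂ y₁∈Y , mono y₀∈Y y₁∈Y y₀<y₁
  Spanned⇒ColourOf B⊆A (vertex {x} x∈B) =
    x , y₀ , proj₁ (const (B⊆A x∈B) y₀∈Y) , inj₁ x∈B , inj₂ y₀∈Y , refl
  Spanned⇒ColourOf _ (edge {x} {y} x∈B y∈B x≢y) with <-cmp x y
  ... | tri< x<y _ _ = x , y , x<y , inj₁ x∈B , inj₁ y∈B , sym (symmetrise-< Δ x<y)
  ... | tri≈ _ x≡y _ = contradiction x≡y x≢y
  ... | tri> _ _ y<x =
    y , x , y<x , inj₁ y∈B , inj₁ x∈B , sym (trans (symmetrise-comm Δ x y) (symmetrise-< Δ y<x))

  ColourOf⇒Spanned : ∀ {B c} → B ⊆ₗ A → ColourOf Δ (B ∪Y) c → Spanned B c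
  ColourOf⇒Spanned _   (x , y , x<y , inj₁ x∈B , inj₁ y∈B , refl) =
    subst (Spanned _) (symmetrise-< Δ x<y) (edge x∈B y∈B (<⇒≢ x<y))
  ColourOf⇒Spanned B⊆A (x , y , x<y , inj₁ x∈B , inj₂ y∈Y , refl) =
    subst (Spanned _) (sym (proj₂ (const (B⊆A x∈B) y∈Y))) (vertex x∈B)
  ColourOf⇒Spanned B⊆A (x , y , x<y , inj₂ x∈Y , inj₁ y∈B , refl) =
    contradiction (proj₁ (const (B⊆A y∈B) x∈Y)) (<⇒≯ x<y)
  ColourOf⇒Spanned _   (x , y , x<y , inj₂ x∈Y , inj₂ y∈Y , refl) =
    subst (Spanned _) (sym (mono x∈Y y∈Y x<y)) root

  Realised⇒InF : ∀ {m} → Realised A m → InF Δ m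
  Realised⇒InF (B , B! , B⊆A , refl) =
    (1≤∣colours∣ , ∣p∣≤n (colours B)) , B ∪Y , (λ a → map₂ (map₂ inj₂) (inf-Y a)) ,
    colours B , refl ,
    λ c → mk⇔ (Spanned⇒ColourOf B⊆A ∘ colours-sound B!) (colours-complete ∘ ColourOf⇒Spanned B⊆A)
    where
    1≤∣colours∣ : 1 ≤ ∣ colours B ∣
    1≤∣colours∣ = ≤-trans (s≤s z≤n) (x∈p⇒∣p-x∣<∣p∣ (colours-complete {B} root))

  k≤∣colours∣ : SpansAll Δ A → k ≤ ∣ colours A ∣
  k≤∣colours∣ spans = ≤-trans (≤-reflexive (sym (∣⊤∣≡n k))) (p⊆q⇒∣p∣≤∣q∣ all∈)
    where
    all∈ : ⊤ ⊆ colours A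
    all∈ {c} _ with spans c
    ... | x , y , x∈A , y∈A , x<y , refl =
      subst (_∈ colours A) (symmetrise-< Δ x<y) (colours-complete (edge x∈A y∈A (<⇒≢ x<y)))

  AtLeastInF-fromSpanning : ∀ {n} → Unique A → SpansAll Δ A → n C 2 < k → AtLeastInF Δ n
  AtLeastInF-fromSpanning A! spans nC2<k =
    let ms , ms! , n≤ , realised = manyRealised (<-wellFounded _) A! (<-≤-trans nC2<k (k≤∣colours∣ spans))
    in  AtLeastInF-fromList ms ms! n≤ (All.map Realised⇒InF realised)

witnessVertices : ∀ {k} {Δ : Colouring k} → Surjective Δ → List ℕ
witnessVertices surj = deduplicate _≟_ (tabulate (proj₁ ∘ surj) ++ tabulate (proj₁ ∘ proj₂ ∘ surj))

witnessVertices-spans : ∀ {k} {Δ : Colouring k} (surj : Surjective Δ) → SpansAll Δ (witnessVertices surj)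
witnessVertices-spans surj c =
  proj₁ (surj c) , proj₁ (proj₂ (surj c)) ,
  ∈-deduplicate⁺ _≟_ (∈-++⁺ˡ (∈-tabulate⁺ {f = proj₁ ∘ surj} c)) ,
  ∈-deduplicate⁺ _≟_ (∈-++⁺ʳ _ (∈-tabulate⁺ {f = proj₁ ∘ proj₂ ∘ surj} c)) ,
  proj₂ (proj₂ (surj c))

theorem1 : ExcludedMiddle 0ℓ → (k n : ℕ) → 2 ≤ k → 2 ≤ n →
    n C 2 + 1 ≤ k → k < suc n C 2 + 1 →
    (Δ : Colouring k) → Surjective Δ → AtLeastInF Δ n
theorem1 em k n _ _ nC2+1≤k _ Δ surj
  with Classical.homogeneousConfiguration em Δ (witnessVertices surj)
... | ρ , Y , inf-Y , mono , consts =
  Configuration.AtLeastInF-fromSpanning Δ inf-Y mono consts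
    (deduplicate-! _) (witnessVertices-spans surj) (subst (_≤ k) (+-comm (n C 2) 1) nC2+1≤k)
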